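{- The randomized algorithm Randomized PivotTracking (described in the context) is $11/9$-competitive against the oblivious adversary for the online graph embedding problem in a star host graph, i.e. for every request sequence $\sigma$, $\mathbb{E}[\mathrm{ALG}(\sigma)]\le \tfrac{11}{9}\,\mathrm{OPT}(\sigma)$.
   Context: Problem: The host graph is a star on $n$ physical hosts: one distinguished central host is at distance $1$ from every other host, and any two distinct non-central hosts are at distance $2$. A set $X$ of $n$ guest nodes is mapped bijectively to the hosts (a configuration); the guest node mapped to the central host is called the central node. An initial configuration is given. Requests arrive one at a time; each request $\sigma_t=\{x_1,x_2\}$ is a pair of distinct guest nodes, and must be served at a cost equal to the host distance between the hosts of $x_1$ and $x_2$ in the current configuration (cost $1$ if one of them is the central node, $2$ otherwise). At any time an algorithm may migrate a guest node to the center (swap it with the current central node) at cost $1$. The cost of an algorithm is the total serving plus migration cost. $\mathrm{OPT}(\sigma)$ is the cost of an optimal offline algorithm on $\sigma$ starting from the same initial configuration. The oblivious adversary fixes the request sequence in advance, without knowing the algorithm's random choices. Algorithm Randomized PivotTracking: Maintain a candidate set $\mathcal{C}$, initially $\{x_{\mathrm{init}}\}$ where $x_{\mathrm{init}}$ is the initial central node. When request $\sigma_t=\{x_1,x_2\}$ is issued: if $\mathcal{C}\cap\sigma_t\neq\emptyset$ (intersection behavior), set $\mathcal{C}\gets\mathcal{C}\cap\sigma_t$, and if no node of $\mathcal{C}$ is currently the central node, migrate a node of $\mathcal{C}$ to the center, chosen uniformly at random among the nodes of $\mathcal{C}$; otherwise (union behavior) set $\mathcal{C}\gets\mathcal{C}\cup\sigma_t$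 and, with probability $1/3$ each, either do nothing, migrate $x_1$ to the center, or migrate $x_2$ to the center. Then serve $\sigma_t$. -}

module Defs where

open import Data.Nat using (ℕ; zero; suc)
open import Data.Bool using (Bool; true; false; if_then_else_; _∨_; _∧_)
open import Data.Fin using (Fin; _≟_)
open import Data.Fin.Subset using (Subset; ⁅_⁆; _∩_; _∪_)
open import Data.Vec using (lookup)
open import Data.List using (List; []; _∷_; map; foldr)
open import Data.List.Relation.Unary.All using (All; []; _∷_)
open import Data.Product using (_×_; _,_)
open import Data.Integer using (+_)
open import Data.Rational using (ℚ; _/_; 0ℚ; 1ℚ; _+_; _*_)
open import Relation.Nullary using (does)
open import Relation.Binary.PropositionalEquality using (_≢_)

-- Since the host graph is a star, every cost in
-- the model depends on the configuration only through which guest node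
-- is the central node; a configuration is therefore represented by its
-- central node.

record Request (n : ℕ) : Set where
  constructor req
  field
    x₁ x₂    : Fin n
    distinct : x₁ ≢ x₂
open Request public

_==_ : {n : ℕ} → Fin n → Fin n → Bool
x == y = does (x ≟ y)

serveCost : {n : ℕ} → Fin n → Request n → ℕ
serveCost c r = if (x₁ r == c) ∨ (x₂ r == c) then 1 else 2

-- cost of migrating y to the center when c is the central node
-- (1, a swap; 0 if y already is the central node)
migCost : {n : ℕ} → Fin n → Fin n → ℕ
migCost c y = if y == c then 0 else 1

migrateAll : {n : ℕ} → Fin n → List (Fin n) → Fin n × ℕ
migrateAll c []       = c , 0
migrateAll c (y ∷ ys) with migrateAll y ys
... | c' , k = c' , migCost c y Data.Nat.+ k

-- Offline algorithms: before serving each request, an arbitrary finite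
-- sequence of migrations.

Schedule : (n : ℕ) → List (Request n) → Set
Schedule n σ = All (λ _ → List (Fin n)) σ

offCost : {n : ℕ} → Fin n → (σ : List (Request n)) → Schedule n σ → ℕ
offCost c []       []       = 0
offCost c (r ∷ rs) (m ∷ ms) with migrateAll c m
... | c' , k = k Data.Nat.+ serveCost c' r Data.Nat.+ offCost c' rs ms

-- Randomized PivotTracking.
-- State: (central node, candidate set 𝒞).  𝒞 evolves deterministically;
-- the central node is random.

pair : {n : ℕ} → Request n → Subset n
pair r = ⁅ x₁ r ⁆ ∪ ⁅ x₂ r ⁆

hits : {n : ℕ} → Subset n → Request n → Bool
hits C r = lookup C (x₁ r) ∨ lookup C (x₂ r)

newCand : {n : ℕ} → Subset n → Request n → Subset n
newCand C r = if hits C r then C ∩ pair r else C ∪ pair r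

ℚ[_/_] : ℕ → (d : ℕ) → .{{_ : Data.Nat.NonZero d}} → ℚ
ℚ[ a / d ] = (+ a) / d

uniformOnPair : {n : ℕ} → Subset n → Request n → List (ℚ × Fin n)
uniformOnPair C' r with lookup C' (x₁ r) | lookup C' (x₂ r)
... | true  | true  = (ℚ[ 1 / 2 ] , x₁ r) ∷ (ℚ[ 1 / 2 ] , x₂ r) ∷ []
... | true  | false = (1ℚ , x₁ r) ∷ []
... | false | true  = (1ℚ , x₂ r) ∷ []
... | false | false = []   -- impossible in intersection behaviour

-- distribution of the central node after the (possible) migration of
-- this step: list of (probability, new central node)
moves : {n : ℕ} → Fin n → Subset n → Request n → List (ℚ × Fin n)
moves c C r with hits C r
... | true  = if lookup (C ∩ pair r) c then (1ℚ , c) ∷ []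
                                         else uniformOnPair (C ∩ pair r) r
... | false = (ℚ[ 1 / 3 ] , c) ∷ (ℚ[ 1 / 3 ] , x₁ r) ∷ (ℚ[ 1 / 3 ] , x₂ r) ∷ []

sumℚ : List ℚ → ℚ
sumℚ = foldr _+_ 0ℚ

fromℕℚ : ℕ → ℚ
fromℕℚ k = ℚ[ k / 1 ]

expCost : {n : ℕ} → Fin n → Subset n → List (Request n) → ℚ
expCost c C []       = 0ℚ
expCost c C (r ∷ rs) =
  sumℚ (map (λ { (p , c') → p * ( fromℕℚ (migCost c c' Data.Nat.+ serveCost c' r)
                                  + expCost c' (newCand C r) rs) })
            (moves c C r))

E-ALG : {n : ℕ} → Fin n → List (Request n) → ℚ
E-ALG x₀ σ = expCost x₀ ⁅ x₀ ⁆ σ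

module Submission where

-- Amortised analysis.  Let m be the distribution of the algorithm's central node (always
-- supported on 𝒞) and o OPT's central node, and take the potential
--
--   Φ = G + ι,   G = max (0, 7/9 − m a, 19/18 − 3/2 m a − 1/2 m b : a ≠ b ∈ 𝒞),
--                ι = 0 if o ∈ 𝒞, and 11/9 otherwise.
--
-- A migration of OPT changes only ι, by at most 11/9 per unit of cost.  When a request is
-- served, OPT's serving cost pays for the change of ι plus a credit of 11/9 (intersection) or
-- 22/9 (union), and the credit covers ALG's expected cost plus the change of G; in the union
-- case the mass of every old candidate is divided by 3, and G rises by at most 4/9 because
-- G ≥ (1 − m a)/3.  So E[ALG] + Φ_end ≤ 11/9 · OPT + Φ_start, where Φ_start = 0 ≤ Φ_end.

open import Defs
open import Algebra.Bundles using (CommutativeRing)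
open import Data.Bool using (true; false; T; if_then_else_; _∨_; _∧_) renaming (_≟_ to _≟ᵇ_)
open import Data.Bool.Properties using (∨-comm; ∨-identityʳ; ∨-zeroʳ; ∧-identityʳ; ∧-zeroʳ)
open import Data.Empty using (⊥-elim)
open import Data.Fin using (Fin; zero; suc; _≟_)
open import Data.Fin.Properties using (any?)
open import Data.Fin.Subset using (Subset; ⁅_⁆; _∩_)
open import Data.List using (List; []; _∷_; map)
open import Data.List.Relation.Unary.All as All using (All; []; _∷_)
open import Data.Nat as ℕ using (ℕ; zero; suc)
open import Data.Product using (_×_; _,_; proj₁; proj₂; ∃-syntax)
open import Data.Rational using (ℚ; 0ℚ; 1ℚ; _+_; _*_; _-_; -_; _/_; _≤_; _⊔_; _≤ᵇ_; mkℚ; nonNegative)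
  renaming (_≟_ to _≟ℚ_)
open import Data.Rational.Properties hiding (_≟_)
open import Data.Sum using (_⊎_; inj₁; inj₂)
open import Data.Vec using (lookup)
open import Data.Vec.Properties using (lookup-zipWith; lookup-replicate)
open import Function using (_∘_; case_of_)
open import Relation.Binary.PropositionalEquality
open import Relation.Nullary using (yes; no; _×-dec_; ¬?)
open import Relation.Nullary.Decidable using (dec-true; dec-false; dec⇒maybe)
import Algebra.Properties.Semiring.Sum as Sum
import Data.Integer as ℤ
import Data.Integer.Properties as ℤ
import Data.Nat.Coprimality as Coprime
import Tactic.RingSolver.Core.AlmostCommutativeRing as ACR
open import Tactic.RingSolver using (solve-∀)

open Sum (CommutativeRing.semiring +-*-commutativeRing)
  using (sum; sum-cong-≗; sum-replicate-zero; ∑-distrib-+; *-distribˡ-sum; *-distribʳ-sum)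

private variable
  n : ℕ
  a b c o : Fin n
  C D : Subset n
  r : Request n

-- Rational arithmetic

ℚ-ring : ACR.AlmostCommutativeRing _ _
ℚ-ring = ACR.fromCommutativeRing +-*-commutativeRing (λ q → dec⇒maybe (0ℚ ≟ℚ q))

κ ½ ⅓ ⅔ 2ℚ : ℚ
κ  = ℚ[ 11 / 9 ]
½  = ℚ[ 1 / 2 ]
⅓  = ℚ[ 1 / 3 ]
⅔  = ℚ[ 2 / 3 ]
2ℚ = fromℕℚ 2

fromℕℚ-+ : (j k : ℕ) → fromℕℚ (j ℕ.+ k) ≡ fromℕℚ j + fromℕℚ k
fromℕℚ-+ j k = begin
  (ℤ.+ (j ℕ.+ k)) / 1
    ≡⟨ cong₂ (λ u v → (u ℤ.+ v) / 1) (sym (ℤ.*-identityʳ (ℤ.+ j))) (sym (ℤ.*-identityʳ (ℤ.+ k))) ⟩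
  integral j + integral k
    ≡⟨ sym (cong₂ _+_ (↥p/↧p≡p (integral j)) (↥p/↧p≡p (integral k))) ⟩
  fromℕℚ j + fromℕℚ k ∎
  where
  open ≡-Reasoning
  integral : ℕ → ℚ
  integral i = mkℚ (ℤ.+ i) 0 (Coprime.sym (Coprime.1-coprimeTo i))

-- Linear inequalities are proved by exhibiting the slack q − p as a nonnegative combination
-- of known slacks; the identity q ≡ p + slack is then a ring identity.

≤-by-slack : ∀ {p q} (s : ℚ) → 0ℚ ≤ s → q ≡ p + s → p ≤ q
≤-by-slack {p} {q} s 0≤s q≡p+s =
  subst (p ≤_) (sym q≡p+s) (subst (_≤ p + s) (+-identityʳ p) (+-monoʳ-≤ p 0≤s))

0≤-diff : ∀ {p q} → p ≤ q → 0ℚ ≤ q - p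
0≤-diff {p} {q} p≤q = subst (_≤ q - p) (+-inverseʳ p) (+-monoˡ-≤ (- p) p≤q)

*-nonneg : ∀ {s t} → 0ℚ ≤ s → 0ℚ ≤ t → 0ℚ ≤ s * t
*-nonneg {s} {t} 0≤s 0≤t =
  nonNegative⁻¹ (s * t) {{nonNeg*nonNeg⇒nonNeg s {{nonNegative 0≤s}} t {{nonNegative 0≤t}}}}

infixl 6 _⊕_
_⊕_ : ∀ {s t} → 0ℚ ≤ s → 0ℚ ≤ t → 0ℚ ≤ s + t
_⊕_ = +-mono-≤

infixl 7 _⊛_
_⊛_ : ∀ (k : ℚ) {_ : T (0ℚ ≤ᵇ k)} {s} → 0ℚ ≤ s → 0ℚ ≤ k * s
_⊛_ k {0≤k} 0≤s = *-nonneg (≤ᵇ⇒≤ {0ℚ} {k} 0≤k) 0≤s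

-- Requests, candidate sets and costs

==-refl : (a : Fin n) → (a == a) ≡ true
==-refl a = dec-true (a ≟ a) refl

≢⇒==-false : a ≢ b → (a == b) ≡ false
≢⇒==-false {a = a} {b} = dec-false (a ≟ b)

lookup-⁅⁆ : (a c : Fin n) → lookup ⁅ a ⁆ c ≡ (a == c)
lookup-⁅⁆ zero    zero    = refl
lookup-⁅⁆ zero    (suc c) = lookup-replicate c false
lookup-⁅⁆ (suc a) zero    = refl
lookup-⁅⁆ (suc a) (suc c) = lookup-⁅⁆ a c

lookup-pair : (r : Request n) (c : Fin n) → lookup (pair r) c ≡ (x₁ r == c) ∨ (x₂ r == c)
lookup-pair r c = trans (lookup-zipWith _∨_ c ⁅ x₁ r ⁆ ⁅ x₂ r ⁆)
                        (cong₂ _∨_ (lookup-⁅⁆ (x₁ r) c) (lookup-⁅⁆ (x₂ r) c))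

x₁∈pair : (r : Request n) → lookup (pair r) (x₁ r) ≡ true
x₁∈pair r = trans (lookup-pair r (x₁ r)) (cong (_∨ (x₂ r == x₁ r)) (==-refl (x₁ r)))

x₂∈pair : (r : Request n) → lookup (pair r) (x₂ r) ≡ true
x₂∈pair r = trans (lookup-pair r (x₂ r)) (cong₂ _∨_ (≢⇒==-false (distinct r)) (==-refl (x₂ r)))

endpoints≢⇒∉pair : (r : Request n) → x₁ r ≢ c → x₂ r ≢ c → lookup (pair r) c ≡ false
endpoints≢⇒∉pair {c = c} r x₁≢c x₂≢c =
  trans (lookup-pair r c) (cong₂ _∨_ (≢⇒==-false x₁≢c) (≢⇒==-false x₂≢c))

∈pair⇒endpoint : lookup (pair r) c ≡ true → x₁ r ≡ c ⊎ x₂ r ≡ c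
∈pair⇒endpoint {r = r} {c} c∈pair with x₁ r ≟ c | x₂ r ≟ c | trans (sym (lookup-pair r c)) c∈pair
... | yes x₁≡c | _        | _  = inj₁ x₁≡c
... | no _     | yes x₂≡c | _  = inj₂ x₂≡c
... | no _     | no _     | ()

lookup-∩-pair : (C : Subset n) (r : Request n) (c : Fin n) →
                lookup (C ∩ pair r) c ≡ lookup C c ∧ lookup (pair r) c
lookup-∩-pair C r c = lookup-zipWith _∧_ c C (pair r)

lookup-newCand-hit : (C : Subset n) (r : Request n) → hits C r ≡ true →
                     ∀ c → lookup (newCand C r) c ≡ lookup (C ∩ pair r) c
lookup-newCand-hit C r hit c rewrite hit = refl

lookup-newCand-miss : (C : Subset n) (r : Request n) → hits C r ≡ false →
                      ∀ c → lookup (newCand C r) c ≡ lookup C c ∨ lookup (pair r) c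
lookup-newCand-miss C r miss c rewrite miss = lookup-zipWith _∨_ c C (pair r)

serveCost-pair : (o : Fin n) (r : Request n) → serveCost o r ≡ (if lookup (pair r) o then 1 else 2)
serveCost-pair o r = cong (if_then 1 else 2) (sym (lookup-pair r o))

serveCost-endpoint : (r : Request n) → lookup (pair r) o ≡ true → serveCost o r ≡ 1
serveCost-endpoint {o = o} r o∈pair = trans (serveCost-pair o r) (cong (if_then 1 else 2) o∈pair)

serveCost-elsewhere : (r : Request n) → lookup (pair r) o ≡ false → serveCost o r ≡ 2
serveCost-elsewhere {o = o} r o∉pair = trans (serveCost-pair o r) (cong (if_then 1 else 2) o∉pair)

migCost-self : (c : Fin n) → migCost c c ≡ 0
migCost-self c = cong (if_then 0 else 1) (==-refl c)

migCost-≢ : b ≢ c → migCost c b ≡ 1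
migCost-≢ b≢c = cong (if_then 0 else 1) (≢⇒==-false b≢c)

stepCost : Request n → Fin n → Fin n → ℚ
stepCost r c c′ = fromℕℚ (migCost c c′ ℕ.+ serveCost c′ r)

stepCost-stay-endpoint : (r : Request n) → lookup (pair r) c ≡ true → stepCost r c c ≡ 1ℚ
stepCost-stay-endpoint {c = c} r c∈pair =
  cong fromℕℚ (cong₂ ℕ._+_ (migCost-self c) (serveCost-endpoint r c∈pair))

stepCost-stay-elsewhere : (r : Request n) → lookup (pair r) c ≡ false → stepCost r c c ≡ 2ℚ
stepCost-stay-elsewhere {c = c} r c∉pair =
  cong fromℕℚ (cong₂ ℕ._+_ (migCost-self c) (serveCost-elsewhere r c∉pair))

stepCost-jump-endpoint : (r : Request n) → b ≢ c → lookup (pair r) b ≡ true → stepCost r c b ≡ 2ℚ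
stepCost-jump-endpoint r b≢c b∈pair =
  cong fromℕℚ (cong₂ ℕ._+_ (migCost-≢ b≢c) (serveCost-endpoint r b∈pair))

moves-miss : (C : Subset n) (r : Request n) → hits C r ≡ false →
             moves c C r ≡ (⅓ , c) ∷ (⅓ , x₁ r) ∷ (⅓ , x₂ r) ∷ []
moves-miss C r miss rewrite miss = refl

moves-stay : (C : Subset n) (r : Request n) → hits C r ≡ true → lookup (C ∩ pair r) c ≡ true →
             moves c C r ≡ (1ℚ , c) ∷ []
moves-stay C r hit c∈C∩pair rewrite hit | c∈C∩pair = refl

moves-jump : (C : Subset n) (r : Request n) → hits C r ≡ true → lookup (C ∩ pair r) c ≡ false →
             moves c C r ≡ uniformOnPair (C ∩ pair r) r
moves-jump C r hit c∉C∩pair rewrite hit | c∉C∩pair = refl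

uniformOnPair-both : lookup D (x₁ r) ≡ true → lookup D (x₂ r) ≡ true →
                     uniformOnPair D r ≡ (½ , x₁ r) ∷ (½ , x₂ r) ∷ []
uniformOnPair-both x₁∈D x₂∈D rewrite x₁∈D | x₂∈D = refl

uniformOnPair-single : (∀ c → lookup D c ≡ (a == c)) → lookup (pair r) a ≡ true →
                       uniformOnPair D r ≡ (1ℚ , a) ∷ []
uniformOnPair-single {D = D} {r = r} D≡⁅a⁆ a∈pair with ∈pair⇒endpoint {r = r} a∈pair
... | inj₁ refl rewrite D≡⁅a⁆ (x₁ r) | D≡⁅a⁆ (x₂ r) | ==-refl (x₁ r) | ≢⇒==-false (distinct r) = refl
... | inj₂ refl rewrite D≡⁅a⁆ (x₁ r) | D≡⁅a⁆ (x₂ r) | ==-refl (x₂ r) | ≢⇒==-false (distinct r ∘ sym)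
  = refl

-- Distributions and expectations

Dist : ℕ → Set
Dist n = Fin n → ℚ

𝔼 : Dist n → (Fin n → ℚ) → ℚ
𝔼 m f = sum (λ c → m c * f c)

𝔼ₗ : List (ℚ × Fin n) → (Fin n → ℚ) → ℚ
𝔼ₗ L f = sumℚ (map (λ (p , c) → p * f c) L)

δ : Fin n → Dist n
δ a c = if a == c then 1ℚ else 0ℚ

δ-self : (a : Fin n) → δ a a ≡ 1ℚ
δ-self a = cong (if_then 1ℚ else 0ℚ) (==-refl a)

δ-≢ : a ≢ c → δ a c ≡ 0ℚ
δ-≢ a≢c = cong (if_then 1ℚ else 0ℚ) (≢⇒==-false a≢c)

sum-mono : {f g : Fin n → ℚ} → (∀ c → f c ≤ g c) → sum f ≤ sum g
sum-mono {zero}  f≤g = ≤-refl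
sum-mono {suc n} f≤g = +-mono-≤ (f≤g zero) (sum-mono (f≤g ∘ suc))

𝔼-δ : (a : Fin n) (f : Fin n → ℚ) → 𝔼 (δ a) f ≡ f a
𝔼-δ {suc n} zero f = begin
  1ℚ * f zero + sum (λ c → 0ℚ * f (suc c))
    ≡⟨ cong₂ _+_ (*-identityˡ (f zero)) (sum-cong-≗ (λ c → *-zeroˡ (f (suc c)))) ⟩
  f zero + sum {n} (λ _ → 0ℚ)
    ≡⟨ cong (f zero +_) (sum-replicate-zero n) ⟩
  f zero + 0ℚ
    ≡⟨ +-identityʳ (f zero) ⟩
  f zero ∎
  where open ≡-Reasoning
𝔼-δ {suc n} (suc a) f = trans (cong (_+ 𝔼 (δ a) (f ∘ suc)) (*-zeroˡ (f zero)))
                              (trans (+-identityˡ _) (𝔼-δ a (f ∘ suc)))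

𝔼-at : (m : Dist n) (a : Fin n) → 𝔼 m (δ a) ≡ m a
𝔼-at m a = trans (sum-cong-≗ (λ c → *-comm (m c) (δ a c))) (𝔼-δ a m)

module _ (m : Dist n) where

  𝔼-+ : (f g : Fin n → ℚ) → 𝔼 m (λ c → f c + g c) ≡ 𝔼 m f + 𝔼 m g
  𝔼-+ f g = trans (sum-cong-≗ (λ c → *-distribˡ-+ (m c) (f c) (g c)))
                  (∑-distrib-+ (λ c → m c * f c) (λ c → m c * g c))

  𝔼-* : (k : ℚ) (f : Fin n → ℚ) → 𝔼 m (λ c → k * f c) ≡ k * 𝔼 m f
  𝔼-* k f = trans (sum-cong-≗ (λ c → swap (m c) k (f c))) (sym (*-distribˡ-sum k (λ c → m c * f c)))
    where
    swap : ∀ u k v → u * (k * v) ≡ k * (u * v)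
    swap = solve-∀ ℚ-ring

  𝔼-affine : sum m ≡ 1ℚ → (k : ℚ) (f : Fin n → ℚ) → 𝔼 m (λ c → k + f c) ≡ k + 𝔼 m f
  𝔼-affine total k f = trans (𝔼-+ (λ _ → k) f) (cong (_+ 𝔼 m f) 𝔼-const)
    where
    𝔼-const : 𝔼 m (λ _ → k) ≡ k
    𝔼-const = trans (sym (*-distribʳ-sum k m)) (trans (cong (_* k) total) (*-identityˡ k))

𝔼-mix : (p q : ℚ) (m₁ m₂ : Dist n) (f : Fin n → ℚ) →
        𝔼 (λ c → p * m₁ c + q * m₂ c) f ≡ p * 𝔼 m₁ f + q * 𝔼 m₂ f
𝔼-mix p q m₁ m₂ f = trans (sum-cong-≗ (λ c → distrib p q (m₁ c) (m₂ c) (f c)))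
  (trans (∑-distrib-+ (λ c → p * (m₁ c * f c)) (λ c → q * (m₂ c * f c)))
         (cong₂ _+_ (sym (*-distribˡ-sum p (λ c → m₁ c * f c)))
                    (sym (*-distribˡ-sum q (λ c → m₂ c * f c)))))
  where
  distrib : ∀ p q u v w → (p * u + q * v) * w ≡ p * (u * w) + q * (v * w)
  distrib = solve-∀ ℚ-ring

𝔼ₗ-cong : {f g : Fin n → ℚ} (L : List (ℚ × Fin n)) →
          All (λ (_ , c) → f c ≡ g c) L → 𝔼ₗ L f ≡ 𝔼ₗ L g
𝔼ₗ-cong []            []       = refl
𝔼ₗ-cong ((p , c) ∷ L) (e ∷ es) = cong₂ _+_ (cong (p *_) e) (𝔼ₗ-cong L es)

expCost-via : (c : Fin n) (C : Subset n) (r : Request n) (rs : List (Request n))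
              {L : List (ℚ × Fin n)} {k : ℚ} → moves c C r ≡ L → All (λ (_ , c′) → stepCost r c c′ ≡ k) L →
              expCost c C (r ∷ rs) ≡ 𝔼ₗ L (λ c′ → k + expCost c′ (newCand C r) rs)
expCost-via c C r rs {L} refl step-costs = 𝔼ₗ-cong L (All.map (cong (_+ _)) step-costs)

record IsDistOn (C : Subset n) (m : Dist n) : Set where
  field
    nonneg   : ∀ c → 0ℚ ≤ m c
    vanishes : ∀ c → lookup C c ≡ false → m c ≡ 0ℚ
    total    : sum m ≡ 1ℚ
open IsDistOn

δ-isDistOn : lookup C a ≡ true → IsDistOn C (δ a)
δ-isDistOn {C = C} {a = a} a∈C = record
  { nonneg   = nonneg-δ
  ; vanishes = vanishes-δ
  ; total    = trans (sum-cong-≗ (λ c → sym (*-identityʳ (δ a c)))) (𝔼-δ a (λ _ → 1ℚ))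
  }
  where
  nonneg-δ : ∀ c → 0ℚ ≤ δ a c
  nonneg-δ c with a == c
  ... | true  = ≤ᵇ⇒≤ _
  ... | false = ≤-refl
  vanishes-δ : ∀ c → lookup C c ≡ false → δ a c ≡ 0ℚ
  vanishes-δ c c∉C with a ≟ c
  ... | yes refl = case trans (sym a∈C) c∉C of λ ()
  ... | no _     = refl

mix-isDistOn : ∀ {p q m₁ m₂} → 0ℚ ≤ p → 0ℚ ≤ q → p + q ≡ 1ℚ →
               IsDistOn C m₁ → IsDistOn C m₂ → IsDistOn C (λ c → p * m₁ c + q * m₂ c)
mix-isDistOn {C = C} {p} {q} {m₁} {m₂} 0≤p 0≤q p+q≡1 d₁ d₂ = record
  { nonneg   = λ c → *-nonneg 0≤p (nonneg d₁ c) ⊕ *-nonneg 0≤q (nonneg d₂ c)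
  ; vanishes = λ c c∉C → trans (cong₂ (λ u v → p * u + q * v) (vanishes d₁ c c∉C) (vanishes d₂ c c∉C))
                               (cong₂ _+_ (*-zeroʳ p) (*-zeroʳ q))
  ; total    = begin
      sum (λ c → p * m₁ c + q * m₂ c)  ≡⟨ ∑-distrib-+ (λ c → p * m₁ c) (λ c → q * m₂ c) ⟩
      sum (λ c → p * m₁ c) + sum (λ c → q * m₂ c)
        ≡⟨ cong₂ _+_ (sym (*-distribˡ-sum p m₁)) (sym (*-distribˡ-sum q m₂)) ⟩
      p * sum m₁ + q * sum m₂          ≡⟨ cong₂ (λ s t → p * s + q * t) (total d₁) (total d₂) ⟩
      p * 1ℚ + q * 1ℚ                  ≡⟨ cong₂ _+_ (*-identityʳ p) (*-identityʳ q) ⟩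
      p + q                            ≡⟨ p+q≡1 ⟩
      1ℚ                               ∎
  }
  where open ≡-Reasoning

widen-isDistOn : {m : Dist n} → (∀ c → lookup C c ≡ true → lookup D c ≡ true) →
                 IsDistOn C m → IsDistOn D m
widen-isDistOn {C = C} {D} {m} C⊆D d = record
  { nonneg = nonneg d ; vanishes = vanishes-D ; total = total d }
  where
  vanishes-D : ∀ c → lookup D c ≡ false → m c ≡ 0ℚ
  vanishes-D c c∉D with lookup C c in c∈C
  ... | true  = case trans (sym (C⊆D c c∈C)) c∉D of λ ()
  ... | false = vanishes d c c∈C

module _ {C : Subset n} {m : Dist n} (d : IsDistOn C m) where

  𝔼-cong-on : {f g : Fin n → ℚ} → (∀ c → lookup C c ≡ true → f c ≡ g c) → 𝔼 m f ≡ 𝔼 m g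
  𝔼-cong-on {f} {g} f≡g-on-C = sum-cong-≗ agree
    where
    agree : ∀ c → m c * f c ≡ m c * g c
    agree c with lookup C c in c∈C
    ... | true  = cong (m c *_) (f≡g-on-C c c∈C)
    ... | false rewrite vanishes d c c∈C = trans (*-zeroˡ (f c)) (sym (*-zeroˡ (g c)))

  𝔼≤1 : {f : Fin n → ℚ} → (∀ c → f c ≤ 1ℚ) → 𝔼 m f ≤ 1ℚ
  𝔼≤1 {f} f≤1 = begin
    sum (λ c → m c * f c)  ≤⟨ sum-mono (λ c → *-monoˡ-≤-nonNeg (m c) {{nonNegative (nonneg d c)}} (f≤1 c)) ⟩
    sum (λ c → m c * 1ℚ)   ≡⟨ sum-cong-≗ (λ c → *-identityʳ (m c)) ⟩
    sum m                  ≡⟨ total d ⟩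
    1ℚ                     ∎
    where open ≤-Reasoning

  mass≤1 : (a : Fin n) → m a ≤ 1ℚ
  mass≤1 a = subst (_≤ 1ℚ) (𝔼-at m a) (𝔼≤1 δ≤1)
    where
    δ≤1 : ∀ c → δ a c ≤ 1ℚ
    δ≤1 c with a == c
    ... | true  = ≤-refl
    ... | false = ≤ᵇ⇒≤ _

  mass₂≤1 : a ≢ b → m a + m b ≤ 1ℚ
  mass₂≤1 {a} {b} a≢b =
    subst (_≤ 1ℚ) (trans (𝔼-+ m (δ a) (δ b)) (cong₂ _+_ (𝔼-at m a) (𝔼-at m b))) (𝔼≤1 δ+δ≤1)
    where
    δ+δ≤1 : ∀ c → δ a c + δ b c ≤ 1ℚ
    δ+δ≤1 c with a ≟ c | b ≟ c
    ... | yes refl | yes refl = ⊥-elim (a≢b refl)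
    ... | yes _    | no _     = ≤ᵇ⇒≤ _
    ... | no _     | yes _    = ≤ᵇ⇒≤ _
    ... | no _     | no _     = ≤ᵇ⇒≤ _

  partner-or-certain : (a : Fin n) → (∃[ b ] lookup C b ≡ true × a ≢ b) ⊎ m a ≡ 1ℚ
  partner-or-certain a with any? (λ b → (lookup C b ≟ᵇ true) ×-dec ¬? (a ≟ b))
  ... | yes partner   = inj₁ partner
  ... | no no-partner = inj₂ (trans (sym (trans (sum-cong-≗ concentrated) (𝔼-δ a m))) (total d))
    where
    concentrated : ∀ c → m c ≡ δ a c * m c
    concentrated c with a ≟ c
    ... | yes refl = sym (*-identityˡ (m c))
    ... | no a≢c with lookup C c in c∈C
    ...   | true  = ⊥-elim (no-partner (c , c∈C , a≢c))
    ...   | false = trans (vanishes d c c∈C) (sym (*-zeroˡ (m c)))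

-- The potential

sup₀ : (Fin n → ℚ) → ℚ
sup₀ {zero}  f = 0ℚ
sup₀ {suc n} f = f zero ⊔ sup₀ (f ∘ suc)

sup₀-nonneg : (f : Fin n → ℚ) → 0ℚ ≤ sup₀ f
sup₀-nonneg {zero}  f = ≤-refl
sup₀-nonneg {suc n} f = ≤-trans (sup₀-nonneg (f ∘ suc)) (p≤q⊔p (f zero) _)

≤-sup₀ : (f : Fin n → ℚ) (a : Fin n) → f a ≤ sup₀ f
≤-sup₀ f zero    = p≤p⊔q (f zero) _
≤-sup₀ f (suc a) = ≤-trans (≤-sup₀ (f ∘ suc) a) (p≤q⊔p (f zero) _)

sup₀-least : {X : ℚ} (f : Fin n → ℚ) → 0ℚ ≤ X → (∀ a → f a ≤ X) → sup₀ f ≤ X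
sup₀-least {zero}  f 0≤X f≤X = 0≤X
sup₀-least {suc n} f 0≤X f≤X = ⊔-lub (f≤X zero) (sup₀-least (f ∘ suc) 0≤X (f≤X ∘ suc))

φ₁ : ℚ → ℚ
φ₁ u = ℚ[ 7 / 9 ] - u

φ₂ : ℚ → ℚ → ℚ
φ₂ u v = ℚ[ 19 / 18 ] - ℚ[ 3 / 2 ] * u - ½ * v

G-term : Subset n → Dist n → Fin n → Fin n → ℚ
G-term C m a b with lookup C a | lookup C b | a ≟ b
... | true | true | yes _ = φ₁ (m a)
... | true | true | no _  = φ₂ (m a) (m b)
... | _    | _    | _     = 0ℚ

G : Subset n → Dist n → ℚ
G C m = sup₀ λ a → sup₀ λ b → G-term C m a b

ι : Subset n → Fin n → ℚ
ι C o = if lookup C o then 0ℚ else κ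

Φ : Subset n → Dist n → Fin n → ℚ
Φ C m o = G C m + ι C o

module _ (C : Subset n) (m : Dist n) where

  G-nonneg : 0ℚ ≤ G C m
  G-nonneg = sup₀-nonneg (λ a → sup₀ (G-term C m a))

  G-term≤G : (a b : Fin n) → G-term C m a b ≤ G C m
  G-term≤G a b = ≤-trans (≤-sup₀ (G-term C m a) b) (≤-sup₀ (λ a → sup₀ (G-term C m a)) a)

  φ₁≤G : lookup C a ≡ true → φ₁ (m a) ≤ G C m
  φ₁≤G {a} a∈C = ≤-trans (≤-reflexive (sym diagonal)) (G-term≤G a a)
    where
    diagonal : G-term C m a a ≡ φ₁ (m a)
    diagonal rewrite a∈C with a ≟ a
    ... | yes _  = refl
    ... | no a≢a = ⊥-elim (a≢a refl)

  φ₂≤G : lookup C a ≡ true → lookup C b ≡ true → a ≢ b → φ₂ (m a) (m b) ≤ G C m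
  φ₂≤G {a} {b} a∈C b∈C a≢b = ≤-trans (≤-reflexive (sym off-diagonal)) (G-term≤G a b)
    where
    off-diagonal : G-term C m a b ≡ φ₂ (m a) (m b)
    off-diagonal rewrite a∈C | b∈C with a ≟ b
    ... | yes a≡b = ⊥-elim (a≢b a≡b)
    ... | no _    = refl

  G-least : {X : ℚ} → 0ℚ ≤ X →
            (∀ a → lookup C a ≡ true → φ₁ (m a) ≤ X) →
            (∀ a b → lookup C a ≡ true → lookup C b ≡ true → a ≢ b → φ₂ (m a) (m b) ≤ X) →
            G C m ≤ X
  G-least {X} 0≤X φ₁≤X φ₂≤X = sup₀-least _ 0≤X λ a → sup₀-least _ 0≤X (G-term≤X a)
    where
    G-term≤X : ∀ a b → G-term C m a b ≤ X
    G-term≤X a b with lookup C a in a∈C | lookup C b in b∈C | a ≟ b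
    ... | true  | true  | yes refl = φ₁≤X a a∈C
    ... | true  | true  | no a≢b   = φ₂≤X a b a∈C b∈C a≢b
    ... | true  | false | _        = 0≤X
    ... | false | _     | _        = 0≤X

G-point : (C : Subset n) → (∀ c → lookup C c ≡ true → c ≡ a) → G C (δ a) ≤ 0ℚ
G-point {a = a} C only-a = G-least C (δ a) ≤-refl φ₁≤0
  (λ b c b∈C c∈C b≢c → ⊥-elim (b≢c (trans (only-a b b∈C) (sym (only-a c c∈C)))))
  where
  φ₁≤0 : ∀ b → lookup C b ≡ true → φ₁ (δ a b) ≤ 0ℚ
  φ₁≤0 b b∈C rewrite only-a b b∈C | δ-self a = ≤ᵇ⇒≤ _

⅓-missing-mass≤G : {C : Subset n} {m : Dist n} → IsDistOn C m →
                   lookup C a ≡ true → ⅓ * (1ℚ - m a) ≤ G C m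
⅓-missing-mass≤G {a = a} {C} {m} d a∈C with partner-or-certain d a
... | inj₁ (b , b∈C , a≢b) =
  ≤-by-slack _ (⅔ ⊛ 0≤-diff (φ₁≤G C m a∈C) ⊕ ⅓ ⊛ 0≤-diff (φ₁≤G C m b∈C)
                ⊕ ⅓ ⊛ 0≤-diff (mass₂≤1 d a≢b) ⊕ ≤ᵇ⇒≤ {0ℚ} {ℚ[ 1 / 9 ]} _)
               (certificate (G C m) (m a) (m b))
  where
  certificate : ∀ g u v → g ≡ ⅓ * (1ℚ - u) + (⅔ * (g - (ℚ[ 7 / 9 ] - u)) + ⅓ * (g - (ℚ[ 7 / 9 ] - v))
                                               + ⅓ * (1ℚ - (u + v)) + ℚ[ 1 / 9 ])
  certificate = solve-∀ ℚ-ring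
... | inj₂ m-a≡1 = subst (λ u → ⅓ * (1ℚ - u) ≤ G C m) (sym m-a≡1) (G-nonneg C m)

share : ℚ → ℚ → ℚ
share u v = u + ½ * (1ℚ - (u + v))

share-φ₁ : ∀ {g} u v → φ₂ u v ≤ g → φ₁ (share u v) ≤ g + (u + v) - ℚ[ 7 / 9 ]
share-φ₁ {g} u v φ₂≤g = ≤-by-slack _ (0≤-diff φ₂≤g) (certificate g u v)
  where
  certificate : ∀ g u v → g + (u + v) - ℚ[ 7 / 9 ]
    ≡ (ℚ[ 7 / 9 ] - (u + ½ * (1ℚ - (u + v)))) + (g - (ℚ[ 19 / 18 ] - ℚ[ 3 / 2 ] * u - ½ * v))
  certificate = solve-∀ ℚ-ring

share-φ₂ : ∀ {g} u v → φ₂ u v ≤ g → φ₂ (share u v) (share v u) ≤ g + (u + v) - ℚ[ 7 / 9 ]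
share-φ₂ {g} u v φ₂≤g = ≤-by-slack _ (0≤-diff φ₂≤g ⊕ ≤ᵇ⇒≤ _) (certificate g u v)
  where
  certificate : ∀ g u v → g + (u + v) - ℚ[ 7 / 9 ]
    ≡ (ℚ[ 19 / 18 ] - ℚ[ 3 / 2 ] * (u + ½ * (1ℚ - (u + v))) - ½ * (v + ½ * (1ℚ - (v + u))))
      + ((g - (ℚ[ 19 / 18 ] - ℚ[ 3 / 2 ] * u - ½ * v)) + ℚ[ 2 / 9 ])
  certificate = solve-∀ ℚ-ring

-- OPT's side: ι

ι-member : (C : Subset n) → lookup C o ≡ true → ι C o ≡ 0ℚ
ι-member C o∈C = cong (if_then 0ℚ else κ) o∈C

ι-nonmember : (C : Subset n) → lookup C o ≡ false → ι C o ≡ κ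
ι-nonmember C o∉C = cong (if_then 0ℚ else κ) o∉C

ι-nonneg : (C : Subset n) (o : Fin n) → 0ℚ ≤ ι C o
ι-nonneg C o with lookup C o
... | true  = ≤-refl
... | false = ≤ᵇ⇒≤ _

ι≤κ : (C : Subset n) (o : Fin n) → ι C o ≤ κ
ι≤κ C o with lookup C o
... | true  = ≤ᵇ⇒≤ _
... | false = ≤-refl

Φ-nonneg : (C : Subset n) (m : Dist n) (o : Fin n) → 0ℚ ≤ Φ C m o
Φ-nonneg C m o = G-nonneg C m ⊕ ι-nonneg C o

ι-migrate-one : (C : Subset n) (o y : Fin n) → ι C y ≤ κ * fromℕℚ (migCost o y) + ι C o
ι-migrate-one C o y with y ≟ o
... | yes refl = ≤-reflexive (sym (+-identityˡ (ι C y)))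
... | no _     = ≤-trans (ι≤κ C y) (≤-by-slack (ι C o) (ι-nonneg C o) refl)

ι-migrate : (C : Subset n) (o : Fin n) (ys : List (Fin n)) →
            ι C (proj₁ (migrateAll o ys)) ≤ κ * fromℕℚ (proj₂ (migrateAll o ys)) + ι C o
ι-migrate C o []       = ≤-reflexive (sym (+-identityˡ (ι C o)))
ι-migrate C o (y ∷ ys) = begin
  ι C (proj₁ (migrateAll y ys))
    ≤⟨ ι-migrate C y ys ⟩
  κ * fromℕℚ k + ι C y
    ≤⟨ +-monoʳ-≤ (κ * fromℕℚ k) (ι-migrate-one C o y) ⟩
  κ * fromℕℚ k + (κ * fromℕℚ (migCost o y) + ι C o)
    ≡⟨ regroup (fromℕℚ k) (fromℕℚ (migCost o y)) (ι C o) ⟩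
  κ * (fromℕℚ (migCost o y) + fromℕℚ k) + ι C o
    ≡⟨ cong (λ s → κ * s + ι C o) (sym (fromℕℚ-+ (migCost o y) k)) ⟩
  κ * fromℕℚ (migCost o y ℕ.+ k) + ι C o ∎
  where
  open ≤-Reasoning
  k = proj₂ (migrateAll y ys)
  regroup : ∀ s t i → κ * s + (κ * t + i) ≡ κ * (t + s) + i
  regroup = solve-∀ ℚ-ring

Φ-migrate : (C : Subset n) (m : Dist n) (o : Fin n) (ys : List (Fin n)) →
            Φ C m (proj₁ (migrateAll o ys)) ≤ κ * fromℕℚ (proj₂ (migrateAll o ys)) + Φ C m o
Φ-migrate C m o ys = begin
  G C m + ι C (proj₁ (migrateAll o ys))               ≤⟨ +-monoʳ-≤ (G C m) (ι-migrate C o ys) ⟩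
  G C m + (κ * fromℕℚ k + ι C o)                      ≡⟨ regroup (G C m) (κ * fromℕℚ k) (ι C o) ⟩
  κ * fromℕℚ k + (G C m + ι C o)                      ∎
  where
  open ≤-Reasoning
  k = proj₂ (migrateAll o ys)
  regroup : ∀ g s i → g + (s + i) ≡ s + (g + i)
  regroup = solve-∀ ℚ-ring

credit-miss : (C : Subset n) (r : Request n) → lookup C (x₁ r) ≡ false → lookup C (x₂ r) ≡ false →
              (o : Fin n) → ι (newCand C r) o + (κ + κ) ≤ κ * fromℕℚ (serveCost o r) + ι C o
credit-miss C r x₁∉C x₂∉C o
  with lookup (pair r) o in o∈pair | lookup-newCand-miss C r (cong₂ _∨_ x₁∉C x₂∉C) o
... | true | C′-o = ≤-reflexive (begin
  ι (newCand C r) o + (κ + κ)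
    ≡⟨ cong (_+ (κ + κ)) (ι-member (newCand C r) (trans C′-o (∨-zeroʳ (lookup C o)))) ⟩
  κ * 1ℚ + κ
    ≡⟨ cong₂ (λ s i → κ * s + i) (sym (cong fromℕℚ (serveCost-endpoint r o∈pair))) (sym (ι-nonmember C o∉C)) ⟩
  κ * fromℕℚ (serveCost o r) + ι C o ∎)
  where
  open ≡-Reasoning
  o∉C : lookup C o ≡ false
  o∉C with ∈pair⇒endpoint {r = r} {o} o∈pair
  ... | inj₁ refl = x₁∉C
  ... | inj₂ refl = x₂∉C
... | false | C′-o = ≤-reflexive (begin
  ι (newCand C r) o + (κ + κ)
    ≡⟨ cong (λ b → (if b then 0ℚ else κ) + (κ + κ)) (trans C′-o (∨-identityʳ (lookup C o))) ⟩
  ι C o + κ * 2ℚ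
    ≡⟨ +-comm (ι C o) (κ * 2ℚ) ⟩
  κ * 2ℚ + ι C o
    ≡⟨ cong (λ s → κ * s + ι C o) (sym (cong fromℕℚ (serveCost-elsewhere r o∈pair))) ⟩
  κ * fromℕℚ (serveCost o r) + ι C o ∎)
  where open ≡-Reasoning

credit-hit : (C : Subset n) (r : Request n) → hits C r ≡ true →
             (o : Fin n) → ι (newCand C r) o + κ ≤ κ * fromℕℚ (serveCost o r) + ι C o
credit-hit C r hit o with lookup (pair r) o in o∈pair
                        | trans (lookup-newCand-hit C r hit o) (lookup-∩-pair C r o)
... | true | C′-o = ≤-reflexive (begin
  ι (newCand C r) o + κ
    ≡⟨ cong (λ b → (if b then 0ℚ else κ) + κ) (trans C′-o (∧-identityʳ (lookup C o))) ⟩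
  ι C o + κ * 1ℚ
    ≡⟨ +-comm (ι C o) (κ * 1ℚ) ⟩
  κ * 1ℚ + ι C o
    ≡⟨ cong (λ s → κ * s + ι C o) (sym (cong fromℕℚ (serveCost-endpoint r o∈pair))) ⟩
  κ * fromℕℚ (serveCost o r) + ι C o ∎)
  where open ≡-Reasoning
... | false | C′-o = begin
  ι (newCand C r) o + κ
    ≡⟨ cong (_+ κ) (ι-nonmember (newCand C r) (trans C′-o (∧-zeroʳ (lookup C o)))) ⟩
  κ * 2ℚ + 0ℚ
    ≤⟨ +-monoʳ-≤ (κ * 2ℚ) (ι-nonneg C o) ⟩
  κ * 2ℚ + ι C o
    ≡⟨ cong (λ s → κ * s + ι C o) (sym (cong fromℕℚ (serveCost-elsewhere r o∈pair))) ⟩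
  κ * fromℕℚ (serveCost o r) + ι C o ∎
  where open ≤-Reasoning

-- One request

-- The amortised inequality for a request, split into ALG's part (alg-bound) and OPT's part
-- (opt-bound), which meet at the credit.
record Transition (C : Subset n) (m : Dist n) (r : Request n) : Set where
  field
    next          : Dist n
    cost credit   : ℚ
    next-isDistOn : IsDistOn (newCand C r) next
    expCost-∷     : ∀ rs → 𝔼 m (λ c → expCost c C (r ∷ rs)) ≡ cost + 𝔼 next (λ c → expCost c (newCand C r) rs)
    alg-bound     : cost + G (newCand C r) next ≤ G C m + credit
    opt-bound     : ∀ o → ι (newCand C r) o + credit ≤ κ * fromℕℚ (serveCost o r) + ι C o

module Union {C : Subset n} {m : Dist n} (d : IsDistOn C m) (r : Request n)
             (x∉C : lookup C (x₁ r) ≡ false) (y∉C : lookup C (x₂ r) ≡ false) where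

  private
    x y : Fin n
    x = x₁ r
    y = x₂ r
    C′ : Subset n
    C′ = newCand C r
    miss : hits C r ≡ false
    miss = cong₂ _∨_ x∉C y∉C

  x≢member : lookup C c ≡ true → x ≢ c
  x≢member c∈C refl = case trans (sym c∈C) x∉C of λ ()

  y≢member : lookup C c ≡ true → y ≢ c
  y≢member c∈C refl = case trans (sym c∈C) y∉C of λ ()

  member∉pair : lookup C c ≡ true → lookup (pair r) c ≡ false
  member∉pair c∈C = endpoints≢⇒∉pair r (x≢member c∈C) (y≢member c∈C)

  C⊆C′ : ∀ c → lookup C c ≡ true → lookup C′ c ≡ true
  C⊆C′ c c∈C = trans (lookup-newCand-miss C r miss c) (cong (_∨ lookup (pair r) c) c∈C)

  pair⊆C′ : ∀ c → lookup (pair r) c ≡ true → lookup C′ c ≡ true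
  pair⊆C′ c c∈pair = trans (lookup-newCand-miss C r miss c) (trans (cong (lookup C c ∨_) c∈pair) (∨-zeroʳ _))

  next : Dist n
  next c = ⅓ * m c + ⅔ * (½ * δ x c + ½ * δ y c)

  next-isDistOn : IsDistOn C′ next
  next-isDistOn = mix-isDistOn (≤ᵇ⇒≤ _) (≤ᵇ⇒≤ _) refl (widen-isDistOn C⊆C′ d)
    (mix-isDistOn (≤ᵇ⇒≤ _) (≤ᵇ⇒≤ _) refl (δ-isDistOn (pair⊆C′ x (x₁∈pair r)))
                                          (δ-isDistOn (pair⊆C′ y (x₂∈pair r))))

  module _ (rs : List (Request n)) where

    private
      E′ : Fin n → ℚ
      E′ c = expCost c C′ rs
      K : ℚ
      K = 2ℚ + ⅔ * (½ * E′ x + ½ * E′ y)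

    expCost-member : (c : Fin n) → lookup C c ≡ true → expCost c C (r ∷ rs) ≡ K + ⅓ * E′ c
    expCost-member c c∈C = begin
      expCost c C (r ∷ rs)
        ≡⟨ expCost-via c C r rs (moves-miss C r miss)
             (stepCost-stay-elsewhere r (member∉pair c∈C)
              ∷ stepCost-jump-endpoint r (x≢member c∈C) (x₁∈pair r)
              ∷ stepCost-jump-endpoint r (y≢member c∈C) (x₂∈pair r) ∷ []) ⟩
      𝔼ₗ ((⅓ , c) ∷ (⅓ , x) ∷ (⅓ , y) ∷ []) (λ c′ → 2ℚ + E′ c′)
        ≡⟨ thirds (E′ c) (E′ x) (E′ y) ⟩
      K + ⅓ * E′ c ∎
      where
      open ≡-Reasoning
      thirds : ∀ e u v → ⅓ * (2ℚ + e) + (⅓ * (2ℚ + u) + (⅓ * (2ℚ + v) + 0ℚ))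
                       ≡ (2ℚ + ⅔ * (½ * u + ½ * v)) + ⅓ * e
      thirds = solve-∀ ℚ-ring

    expCost-∷ : 𝔼 m (λ c → expCost c C (r ∷ rs)) ≡ 2ℚ + 𝔼 next E′
    expCost-∷ = begin
      𝔼 m (λ c → expCost c C (r ∷ rs))
        ≡⟨ 𝔼-cong-on d expCost-member ⟩
      𝔼 m (λ c → K + ⅓ * E′ c)
        ≡⟨ 𝔼-affine m (total d) K (λ c → ⅓ * E′ c) ⟩
      K + 𝔼 m (λ c → ⅓ * E′ c)
        ≡⟨ cong (K +_) (𝔼-* m ⅓ E′) ⟩
      K + ⅓ * 𝔼 m E′
        ≡⟨ regroup 2ℚ (⅔ * (½ * E′ x + ½ * E′ y)) (⅓ * 𝔼 m E′) ⟩
      2ℚ + (⅓ * 𝔼 m E′ + ⅔ * (½ * E′ x + ½ * E′ y))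
        ≡⟨ cong (λ t → 2ℚ + (⅓ * 𝔼 m E′ + ⅔ * t)) (sym 𝔼-new) ⟩
      2ℚ + (⅓ * 𝔼 m E′ + ⅔ * 𝔼 new E′)
        ≡⟨ cong (2ℚ +_) (sym (𝔼-mix ⅓ ⅔ m new E′)) ⟩
      2ℚ + 𝔼 next E′ ∎
      where
      open ≡-Reasoning
      new : Dist n
      new c = ½ * δ x c + ½ * δ y c
      𝔼-new : 𝔼 new E′ ≡ ½ * E′ x + ½ * E′ y
      𝔼-new = trans (𝔼-mix ½ ½ (δ x) (δ y) E′) (cong₂ (λ u v → ½ * u + ½ * v) (𝔼-δ x E′) (𝔼-δ y E′))
      regroup : ∀ a s t → (a + s) + t ≡ a + (t + s)
      regroup = solve-∀ ℚ-ring

  next-value : ∀ {u v w} → m a ≡ u → δ x a ≡ v → δ y a ≡ w → next a ≡ ⅓ * u + ⅔ * (½ * v + ½ * w)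
  next-value refl refl refl = refl

  next-on-C′ : lookup C′ a ≡ true → (lookup C a ≡ true × next a ≡ ⅓ * m a) ⊎ next a ≡ ⅓
  next-on-C′ {a} a∈C′ with lookup C a in a∈C
  ... | true  = inj₁ (refl , trans (next-value refl (δ-≢ (x≢member a∈C)) (δ-≢ (y≢member a∈C))) (drop-zeros (m a)))
    where
    drop-zeros : ∀ u → ⅓ * u + ⅔ * (½ * 0ℚ + ½ * 0ℚ) ≡ ⅓ * u
    drop-zeros = solve-∀ ℚ-ring
  ... | false with ∈pair⇒endpoint {r = r}
                     (trans (cong (_∨ lookup (pair r) a) (sym a∈C)) (trans (sym (lookup-newCand-miss C r miss a)) a∈C′))
  ...   | inj₁ refl = inj₂ (next-value (vanishes d x a∈C) (δ-self x) (δ-≢ (distinct r ∘ sym)))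
  ...   | inj₂ refl = inj₂ (next-value (vanishes d y a∈C) (δ-≢ (distinct r)) (δ-self y))

  φ₁-next≤ : ∀ a → lookup C′ a ≡ true → φ₁ (next a) ≤ G C m + ℚ[ 4 / 9 ]
  φ₁-next≤ a a∈C′ with next-on-C′ a∈C′
  ... | inj₁ (a∈C , old) = subst (λ t → φ₁ t ≤ _) (sym old)
                             (≤-by-slack _ (0≤-diff (⅓-missing-mass≤G d a∈C)) (φ₁-old (G C m) (m a)))
    where
    φ₁-old : ∀ g u → g + ℚ[ 4 / 9 ] ≡ (ℚ[ 7 / 9 ] - ⅓ * u) + (g - ⅓ * (1ℚ - u))
    φ₁-old = solve-∀ ℚ-ring
  ... | inj₂ new = subst (λ t → φ₁ t ≤ _) (sym new) (≤-by-slack _ (G-nonneg C m) (φ₁-new (G C m)))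
    where
    φ₁-new : ∀ g → g + ℚ[ 4 / 9 ] ≡ (ℚ[ 7 / 9 ] - ⅓) + g
    φ₁-new = solve-∀ ℚ-ring

  φ₂-next≤ : ∀ a b → lookup C′ a ≡ true → lookup C′ b ≡ true → a ≢ b →
             φ₂ (next a) (next b) ≤ G C m + ℚ[ 4 / 9 ]
  φ₂-next≤ a b a∈C′ b∈C′ a≢b with next-on-C′ a∈C′ | next-on-C′ b∈C′
  ... | inj₁ (a∈C , old-a) | inj₁ (b∈C , old-b) = subst₂ (λ t t′ → φ₂ t t′ ≤ _) (sym old-a) (sym old-b)
        (≤-by-slack _ (⅔ ⊛ 0≤-diff (φ₁≤G C m a∈C) ⊕ ⅓ ⊛ 0≤-diff (φ₁≤G C m b∈C)
                       ⊕ ℚ[ 1 / 6 ] ⊛ 0≤-diff (mass₂≤1 d a≢b))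
                      (old-old (G C m) (m a) (m b)))
    where
    old-old : ∀ g u v → g + ℚ[ 4 / 9 ] ≡ (ℚ[ 19 / 18 ] - ℚ[ 3 / 2 ] * (⅓ * u) - ½ * (⅓ * v))
      + (⅔ * (g - (ℚ[ 7 / 9 ] - u)) + ⅓ * (g - (ℚ[ 7 / 9 ] - v)) + ℚ[ 1 / 6 ] * (1ℚ - (u + v)))
    old-old = solve-∀ ℚ-ring
  ... | inj₁ (a∈C , old-a) | inj₂ new-b = subst₂ (λ t t′ → φ₂ t t′ ≤ _) (sym old-a) (sym new-b)
        (≤-by-slack _ (ℚ[ 1 / 4 ] ⊛ 0≤-diff (φ₁≤G C m a∈C)
                       ⊕ ℚ[ 3 / 4 ] ⊛ 0≤-diff (⅓-missing-mass≤G d a∈C))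
                      (old-new (G C m) (m a)))
    where
    old-new : ∀ g u → g + ℚ[ 4 / 9 ] ≡ (ℚ[ 19 / 18 ] - ℚ[ 3 / 2 ] * (⅓ * u) - ½ * ⅓)
      + (ℚ[ 1 / 4 ] * (g - (ℚ[ 7 / 9 ] - u)) + ℚ[ 3 / 4 ] * (g - ⅓ * (1ℚ - u)))
    old-new = solve-∀ ℚ-ring
  ... | inj₂ new-a | inj₁ (b∈C , old-b) = subst₂ (λ t t′ → φ₂ t t′ ≤ _) (sym new-a) (sym old-b)
        (≤-by-slack _ (0≤-diff (⅓-missing-mass≤G d b∈C) ⊕ ℚ[ 1 / 6 ] ⊛ 0≤-diff (mass≤1 d b) ⊕ ≤ᵇ⇒≤ _)
                      (new-old (G C m) (m b)))
    where
    new-old : ∀ g v → g + ℚ[ 4 / 9 ] ≡ (ℚ[ 19 / 18 ] - ℚ[ 3 / 2 ] * ⅓ - ½ * (⅓ * v))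
      + ((g - ⅓ * (1ℚ - v)) + ℚ[ 1 / 6 ] * (1ℚ - v) + ℚ[ 1 / 18 ])
    new-old = solve-∀ ℚ-ring
  ... | inj₂ new-a | inj₂ new-b = subst₂ (λ t t′ → φ₂ t t′ ≤ _) (sym new-a) (sym new-b)
        (≤-by-slack _ (G-nonneg C m ⊕ ≤ᵇ⇒≤ _) (new-new (G C m)))
    where
    new-new : ∀ g → g + ℚ[ 4 / 9 ] ≡ (ℚ[ 19 / 18 ] - ℚ[ 3 / 2 ] * ⅓ - ½ * ⅓) + (g + ℚ[ 1 / 18 ])
    new-new = solve-∀ ℚ-ring

  G-next : G C′ next ≤ G C m + ℚ[ 4 / 9 ]
  G-next = G-least C′ next (G-nonneg C m ⊕ ≤ᵇ⇒≤ _) φ₁-next≤ φ₂-next≤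

  transition : Transition C m r
  transition = record
    { next          = next
    ; cost          = 2ℚ
    ; credit        = κ + κ
    ; next-isDistOn = next-isDistOn
    ; expCost-∷     = expCost-∷
    ; alg-bound     = ≤-by-slack _ (0≤-diff G-next) (regroup (G C m) (G C′ next))
    ; opt-bound     = credit-miss C r x∉C y∉C
    }
    where
    regroup : ∀ g g′ → g + (κ + κ) ≡ 2ℚ + g′ + ((g + ℚ[ 4 / 9 ]) - g′)
    regroup = solve-∀ ℚ-ring

-- a is the endpoint of r inside 𝒞 and z the one outside; pair≡⁅a,z⁆ makes the module
-- independent of the orientation of r.
module Intersection₁ {C : Subset n} {m : Dist n} (d : IsDistOn C m) (r : Request n) (a z : Fin n)
                     (a∈C : lookup C a ≡ true) (z∉C : lookup C z ≡ false)
                     (pair≡⁅a,z⁆ : ∀ c → lookup (pair r) c ≡ (a == c) ∨ (z == c)) (hit : hits C r ≡ true) where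

  private
    C′ : Subset n
    C′ = newCand C r

  a∈pair : lookup (pair r) a ≡ true
  a∈pair = trans (pair≡⁅a,z⁆ a) (cong (_∨ (z == a)) (==-refl a))

  C∩pair≡⁅a⁆ : ∀ c → lookup (C ∩ pair r) c ≡ (a == c)
  C∩pair≡⁅a⁆ c = trans (lookup-∩-pair C r c) (trans (cong (lookup C c ∧_) (pair≡⁅a,z⁆ c)) only-a)
    where
    only-a : lookup C c ∧ ((a == c) ∨ (z == c)) ≡ (a == c)
    only-a with a ≟ c | z ≟ c
    ... | yes refl | _        = cong (_∧ true) a∈C
    ... | no _     | yes refl = cong (_∧ true) z∉C
    ... | no _     | no _     = ∧-zeroʳ (lookup C c)

  C′≡⁅a⁆ : ∀ c → lookup C′ c ≡ (a == c)
  C′≡⁅a⁆ c = trans (lookup-newCand-hit C r hit c) (C∩pair≡⁅a⁆ c)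

  C′-only-a : ∀ c → lookup C′ c ≡ true → c ≡ a
  C′-only-a c c∈C′ with a ≟ c | trans (sym (C′≡⁅a⁆ c)) c∈C′
  ... | yes a≡c | _ = sym a≡c

  moves-member : lookup C c ≡ true → moves c C r ≡ (1ℚ , a) ∷ []
  moves-member {c} c∈C with a ≟ c
  ... | yes refl = moves-stay C r hit (trans (C∩pair≡⁅a⁆ a) (==-refl a))
  ... | no a≢c   = trans (moves-jump C r hit (trans (C∩pair≡⁅a⁆ c) (≢⇒==-false a≢c)))
                         (uniformOnPair-single {D = C ∩ pair r} C∩pair≡⁅a⁆ a∈pair)

  module _ (rs : List (Request n)) where

    private
      E′ : Fin n → ℚ
      E′ c = expCost c C′ rs

    expCost-member : (c : Fin n) → lookup C c ≡ true → expCost c C (r ∷ rs) ≡ (2ℚ + E′ a) + (- 1ℚ) * δ a c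
    expCost-member c c∈C with a ≟ c
    ... | yes refl = trans (expCost-via c C r rs (moves-member c∈C) (stepCost-stay-endpoint r a∈pair ∷ []))
                           (stay (E′ a))
      where
      stay : ∀ e → 1ℚ * (1ℚ + e) + 0ℚ ≡ (2ℚ + e) + (- 1ℚ) * 1ℚ
      stay = solve-∀ ℚ-ring
    ... | no a≢c   = trans (expCost-via c C r rs (moves-member c∈C) (stepCost-jump-endpoint r a≢c a∈pair ∷ []))
                           (jump (E′ a))
      where
      jump : ∀ e → 1ℚ * (2ℚ + e) + 0ℚ ≡ (2ℚ + e) + (- 1ℚ) * 0ℚ
      jump = solve-∀ ℚ-ring

    expCost-∷ : 𝔼 m (λ c → expCost c C (r ∷ rs)) ≡ (2ℚ - m a) + 𝔼 (δ a) E′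
    expCost-∷ = begin
      𝔼 m (λ c → expCost c C (r ∷ rs))
        ≡⟨ 𝔼-cong-on d expCost-member ⟩
      𝔼 m (λ c → (2ℚ + E′ a) + (- 1ℚ) * δ a c)
        ≡⟨ 𝔼-affine m (total d) (2ℚ + E′ a) (λ c → (- 1ℚ) * δ a c) ⟩
      (2ℚ + E′ a) + 𝔼 m (λ c → (- 1ℚ) * δ a c)
        ≡⟨ cong ((2ℚ + E′ a) +_) (trans (𝔼-* m (- 1ℚ) (δ a)) (cong ((- 1ℚ) *_) (𝔼-at m a))) ⟩
      (2ℚ + E′ a) + (- 1ℚ) * m a
        ≡⟨ regroup (E′ a) (m a) ⟩
      (2ℚ - m a) + E′ a
        ≡⟨ cong ((2ℚ - m a) +_) (sym (𝔼-δ a E′)) ⟩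
      (2ℚ - m a) + 𝔼 (δ a) E′ ∎
      where
      open ≡-Reasoning
      regroup : ∀ e u → (2ℚ + e) + (- 1ℚ) * u ≡ (2ℚ - u) + e
      regroup = solve-∀ ℚ-ring

  transition : Transition C m r
  transition = record
    { next          = δ a
    ; cost          = 2ℚ - m a
    ; credit        = κ
    ; next-isDistOn = δ-isDistOn (trans (C′≡⁅a⁆ a) (==-refl a))
    ; expCost-∷     = expCost-∷
    ; alg-bound     = ≤-by-slack _ (0≤-diff (φ₁≤G C m a∈C) ⊕ 0≤-diff (G-point C′ C′-only-a))
                                 (regroup (G C m) (G C′ (δ a)) (m a))
    ; opt-bound     = credit-hit C r hit
    }
    where
    regroup : ∀ g g′ u → g + κ ≡ (2ℚ - u) + g′ + ((g - (ℚ[ 7 / 9 ] - u)) + (0ℚ - g′))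
    regroup = solve-∀ ℚ-ring

module Intersection₂ {C : Subset n} {m : Dist n} (d : IsDistOn C m) (r : Request n)
                     (x∈C : lookup C (x₁ r) ≡ true) (y∈C : lookup C (x₂ r) ≡ true) where

  private
    x y : Fin n
    x = x₁ r
    y = x₂ r
    C′ : Subset n
    C′ = newCand C r
    hit : hits C r ≡ true
    hit = cong₂ _∨_ x∈C y∈C

  C∩pair≡pair : ∀ c → lookup (C ∩ pair r) c ≡ lookup (pair r) c
  C∩pair≡pair c = trans (lookup-∩-pair C r c) pair⊆C
    where
    pair⊆C : lookup C c ∧ lookup (pair r) c ≡ lookup (pair r) c
    pair⊆C with lookup (pair r) c in c∈pair
    ... | false = ∧-zeroʳ (lookup C c)
    ... | true with ∈pair⇒endpoint {r = r} c∈pair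
    ...   | inj₁ refl = cong (_∧ true) x∈C
    ...   | inj₂ refl = cong (_∧ true) y∈C

  C′≡pair : ∀ c → lookup C′ c ≡ lookup (pair r) c
  C′≡pair c = trans (lookup-newCand-hit C r hit c) (C∩pair≡pair c)

  C′-endpoints : lookup C′ c ≡ true → x ≡ c ⊎ y ≡ c
  C′-endpoints {c} c∈C′ = ∈pair⇒endpoint {r = r} (trans (sym (C′≡pair c)) c∈C′)

  next : Dist n
  next c = share (m x) (m y) * δ x c + share (m y) (m x) * δ y c

  next-x : next x ≡ share (m x) (m y)
  next-x = trans (cong₂ (λ s t → share (m x) (m y) * s + share (m y) (m x) * t) (δ-self x) (δ-≢ (distinct r ∘ sym)))
                 (pick-first (share (m x) (m y)) (share (m y) (m x)))
    where
    pick-first : ∀ s t → s * 1ℚ + t * 0ℚ ≡ s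
    pick-first = solve-∀ ℚ-ring

  next-y : next y ≡ share (m y) (m x)
  next-y = trans (cong₂ (λ s t → share (m x) (m y) * s + share (m y) (m x) * t) (δ-≢ (distinct r)) (δ-self y))
                 (pick-second (share (m x) (m y)) (share (m y) (m x)))
    where
    pick-second : ∀ s t → s * 0ℚ + t * 1ℚ ≡ t
    pick-second = solve-∀ ℚ-ring

  next-isDistOn : IsDistOn C′ next
  next-isDistOn = mix-isDistOn (share-nonneg (distinct r)) (share-nonneg (distinct r ∘ sym)) (shares-sum (m x) (m y))
                    (δ-isDistOn (trans (C′≡pair x) (x₁∈pair r))) (δ-isDistOn (trans (C′≡pair y) (x₂∈pair r)))
    where
    share-nonneg : ∀ {a b} → a ≢ b → 0ℚ ≤ share (m a) (m b)
    share-nonneg {a} a≢b = nonneg d a ⊕ ½ ⊛ 0≤-diff (mass₂≤1 d a≢b)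
    shares-sum : ∀ u v → (u + ½ * (1ℚ - (u + v))) + (v + ½ * (1ℚ - (v + u))) ≡ 1ℚ
    shares-sum = solve-∀ ℚ-ring

  module _ (rs : List (Request n)) where

    private
      E′ : Fin n → ℚ
      E′ c = expCost c C′ rs
      A Bx By : ℚ
      A  = 2ℚ + ½ * E′ x + ½ * E′ y
      Bx = 1ℚ + E′ x - A
      By = 1ℚ + E′ y - A

    expCost-member : (c : Fin n) → lookup C c ≡ true → expCost c C (r ∷ rs) ≡ A + (Bx * δ x c + By * δ y c)
    expCost-member c c∈C with x ≟ c | y ≟ c
    ... | yes refl | yes y≡x = ⊥-elim (distinct r (sym y≡x))
    ... | yes refl | no _    = trans
      (expCost-via c C r rs (moves-stay C r hit (trans (C∩pair≡pair x) (x₁∈pair r)))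
                            (stepCost-stay-endpoint r (x₁∈pair r) ∷ []))
      (at-x (E′ x) (E′ y))
      where
      at-x : ∀ e f → 1ℚ * (1ℚ + e) + 0ℚ
        ≡ (2ℚ + ½ * e + ½ * f) + ((1ℚ + e - (2ℚ + ½ * e + ½ * f)) * 1ℚ + (1ℚ + f - (2ℚ + ½ * e + ½ * f)) * 0ℚ)
      at-x = solve-∀ ℚ-ring
    ... | no _     | yes refl = trans
      (expCost-via c C r rs (moves-stay C r hit (trans (C∩pair≡pair y) (x₂∈pair r)))
                            (stepCost-stay-endpoint r (x₂∈pair r) ∷ []))
      (at-y (E′ x) (E′ y))
      where
      at-y : ∀ e f → 1ℚ * (1ℚ + f) + 0ℚ
        ≡ (2ℚ + ½ * e + ½ * f) + ((1ℚ + e - (2ℚ + ½ * e + ½ * f)) * 0ℚ + (1ℚ + f - (2ℚ + ½ * e + ½ * f)) * 1ℚ)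
      at-y = solve-∀ ℚ-ring
    ... | no x≢c   | no y≢c   = trans
      (expCost-via c C r rs
        (trans (moves-jump C r hit (trans (C∩pair≡pair c) (endpoints≢⇒∉pair r x≢c y≢c)))
               (uniformOnPair-both {D = C ∩ pair r} (trans (C∩pair≡pair x) (x₁∈pair r))
                                                    (trans (C∩pair≡pair y) (x₂∈pair r))))
        (stepCost-jump-endpoint r x≢c (x₁∈pair r) ∷ stepCost-jump-endpoint r y≢c (x₂∈pair r) ∷ []))
      (elsewhere (E′ x) (E′ y))
      where
      elsewhere : ∀ e f → ½ * (2ℚ + e) + (½ * (2ℚ + f) + 0ℚ)
        ≡ (2ℚ + ½ * e + ½ * f) + ((1ℚ + e - (2ℚ + ½ * e + ½ * f)) * 0ℚ + (1ℚ + f - (2ℚ + ½ * e + ½ * f)) * 0ℚ)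
      elsewhere = solve-∀ ℚ-ring

    expCost-∷ : 𝔼 m (λ c → expCost c C (r ∷ rs)) ≡ (2ℚ - (m x + m y)) + 𝔼 next E′
    expCost-∷ = begin
      𝔼 m (λ c → expCost c C (r ∷ rs))
        ≡⟨ 𝔼-cong-on d expCost-member ⟩
      𝔼 m (λ c → A + (Bx * δ x c + By * δ y c))
        ≡⟨ 𝔼-affine m (total d) A (λ c → Bx * δ x c + By * δ y c) ⟩
      A + 𝔼 m (λ c → Bx * δ x c + By * δ y c)
        ≡⟨ cong (A +_) (trans (𝔼-+ m (λ c → Bx * δ x c) (λ c → By * δ y c))
                              (cong₂ _+_ (trans (𝔼-* m Bx (δ x)) (cong (Bx *_) (𝔼-at m x)))
                                         (trans (𝔼-* m By (δ y)) (cong (By *_) (𝔼-at m y))))) ⟩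
      A + (Bx * m x + By * m y)
        ≡⟨ regroup (E′ x) (E′ y) (m x) (m y) ⟩
      (2ℚ - (m x + m y)) + (share (m x) (m y) * E′ x + share (m y) (m x) * E′ y)
        ≡⟨ cong ((2ℚ - (m x + m y)) +_) (sym 𝔼-next) ⟩
      (2ℚ - (m x + m y)) + 𝔼 next E′ ∎
      where
      open ≡-Reasoning
      𝔼-next : 𝔼 next E′ ≡ share (m x) (m y) * E′ x + share (m y) (m x) * E′ y
      𝔼-next = trans (𝔼-mix (share (m x) (m y)) (share (m y) (m x)) (δ x) (δ y) E′)
                     (cong₂ (λ s t → share (m x) (m y) * s + share (m y) (m x) * t) (𝔼-δ x E′) (𝔼-δ y E′))
      regroup : ∀ e f u v
        → (2ℚ + ½ * e + ½ * f) + ((1ℚ + e - (2ℚ + ½ * e + ½ * f)) * u + (1ℚ + f - (2ℚ + ½ * e + ½ * f)) * v)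
                ≡ (2ℚ - (u + v)) + ((u + ½ * (1ℚ - (u + v))) * e + (v + ½ * (1ℚ - (v + u))) * f)
      regroup = solve-∀ ℚ-ring

  φ₂xy≤G : φ₂ (m x) (m y) ≤ G C m
  φ₂xy≤G = φ₂≤G C m x∈C y∈C (distinct r)

  φ₂yx≤G : φ₂ (m y) (m x) ≤ G C m
  φ₂yx≤G = φ₂≤G C m y∈C x∈C (distinct r ∘ sym)

  swapped : G C m + (m y + m x) - ℚ[ 7 / 9 ] ≡ G C m + (m x + m y) - ℚ[ 7 / 9 ]
  swapped = cong (λ s → G C m + s - ℚ[ 7 / 9 ]) (+-comm (m y) (m x))

  φ₁-next≤ : ∀ a → lookup C′ a ≡ true → φ₁ (next a) ≤ G C m + (m x + m y) - ℚ[ 7 / 9 ]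
  φ₁-next≤ a a∈C′ with C′-endpoints a∈C′
  ... | inj₁ refl = subst (λ t → φ₁ t ≤ G C m + (m x + m y) - ℚ[ 7 / 9 ]) (sym next-x)
                          (share-φ₁ (m x) (m y) φ₂xy≤G)
  ... | inj₂ refl = subst₂ (λ t s → φ₁ t ≤ s) (sym next-y) swapped (share-φ₁ (m y) (m x) φ₂yx≤G)

  φ₂-next≤ : ∀ a b → lookup C′ a ≡ true → lookup C′ b ≡ true → a ≢ b →
             φ₂ (next a) (next b) ≤ G C m + (m x + m y) - ℚ[ 7 / 9 ]
  φ₂-next≤ a b a∈C′ b∈C′ a≢b with C′-endpoints a∈C′ | C′-endpoints b∈C′
  ... | inj₁ refl | inj₁ refl = ⊥-elim (a≢b refl)
  ... | inj₂ refl | inj₂ refl = ⊥-elim (a≢b refl)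
  ... | inj₁ refl | inj₂ refl =
    subst₂ (λ t t′ → φ₂ t t′ ≤ G C m + (m x + m y) - ℚ[ 7 / 9 ]) (sym next-x) (sym next-y)
    (share-φ₂ (m x) (m y) φ₂xy≤G)
  ... | inj₂ refl | inj₁ refl = subst₂ (λ t s → φ₂ t (next x) ≤ s) (sym next-y) swapped
    (subst (λ t → φ₂ (share (m y) (m x)) t ≤ G C m + (m y + m x) - ℚ[ 7 / 9 ]) (sym next-x)
           (share-φ₂ (m y) (m x) φ₂yx≤G))

  G-next : G C′ next ≤ G C m + (m x + m y) - ℚ[ 7 / 9 ]
  G-next = G-least C′ next 0≤bound φ₁-next≤ φ₂-next≤
    where
    0≤bound : 0ℚ ≤ G C m + (m x + m y) - ℚ[ 7 / 9 ]
    0≤bound = ≤-by-slack _ (½ ⊛ 0≤-diff φ₂xy≤G ⊕ ½ ⊛ 0≤-diff φ₂yx≤G ⊕ ≤ᵇ⇒≤ _) (average (G C m) (m x) (m y))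
      where
      average : ∀ g u v → g + (u + v) - ℚ[ 7 / 9 ] ≡ 0ℚ + (½ * (g - (ℚ[ 19 / 18 ] - ℚ[ 3 / 2 ] * u - ½ * v))
                  + ½ * (g - (ℚ[ 19 / 18 ] - ℚ[ 3 / 2 ] * v - ½ * u)) + ℚ[ 5 / 18 ])
      average = solve-∀ ℚ-ring

  transition : Transition C m r
  transition = record
    { next          = next
    ; cost          = 2ℚ - (m x + m y)
    ; credit        = κ
    ; next-isDistOn = next-isDistOn
    ; expCost-∷     = expCost-∷
    ; alg-bound     = ≤-by-slack _ (0≤-diff G-next) (regroup (G C m) (G C′ next) (m x + m y))
    ; opt-bound     = credit-hit C r hit
    }
    where
    regroup : ∀ g g′ s → g + κ ≡ (2ℚ - s) + g′ + ((g + s - ℚ[ 7 / 9 ]) - g′)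
    regroup = solve-∀ ℚ-ring

transition : {C : Subset n} {m : Dist n} → IsDistOn C m → (r : Request n) → Transition C m r
transition {C = C} d r with lookup C (x₁ r) in x₁∈ | lookup C (x₂ r) in x₂∈
... | false | false = Union.transition d r x₁∈ x₂∈
... | true  | true  = Intersection₂.transition d r x₁∈ x₂∈
... | true  | false = Intersection₁.transition d r (x₁ r) (x₂ r) x₁∈ x₂∈
                        (lookup-pair r) (cong₂ _∨_ x₁∈ x₂∈)
... | false | true  = Intersection₁.transition d r (x₂ r) (x₁ r) x₂∈ x₁∈
                        (λ c → trans (lookup-pair r c) (∨-comm (x₁ r == c) (x₂ r == c))) (cong₂ _∨_ x₁∈ x₂∈)

-- The whole sequence

amortized-step : {C : Subset n} {m : Dist n} {r : Request n} (step : Transition C m r) (o : Fin n) →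
                 Transition.cost step + Φ (newCand C r) (Transition.next step) o
                   ≤ κ * fromℕℚ (serveCost o r) + Φ C m o
amortized-step {n} {C} {m} {r} step o = begin
  cost + (G C′ next + ι C′ o)                  ≡⟨ sym (+-assoc cost (G C′ next) (ι C′ o)) ⟩
  (cost + G C′ next) + ι C′ o                  ≤⟨ +-monoˡ-≤ (ι C′ o) alg-bound ⟩
  (G C m + credit) + ι C′ o                    ≡⟨ regroup (G C m) credit (ι C′ o) ⟩
  G C m + (ι C′ o + credit)                    ≤⟨ +-monoʳ-≤ (G C m) (opt-bound o) ⟩
  G C m + (κ * fromℕℚ (serveCost o r) + ι C o) ≡⟨ regroup′ (G C m) (κ * fromℕℚ (serveCost o r)) (ι C o) ⟩
  κ * fromℕℚ (serveCost o r) + (G C m + ι C o) ∎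
  where
  open Transition step
  open ≤-Reasoning
  C′ : Subset n
  C′ = newCand C r
  regroup : ∀ g k i → (g + k) + i ≡ g + (i + k)
  regroup = solve-∀ ℚ-ring
  regroup′ : ∀ g s i → g + (s + i) ≡ s + (g + i)
  regroup′ = solve-∀ ℚ-ring

amortized : {C : Subset n} {m : Dist n} → IsDistOn C m → (σ : List (Request n)) (s : Schedule n σ) (o : Fin n) →
            𝔼 m (λ c → expCost c C σ) ≤ κ * fromℕℚ (offCost o σ s) + Φ C m o
amortized {n} {C} {m} d [] [] o = begin
  𝔼 m (λ _ → 0ℚ)  ≡⟨ trans (sum-cong-≗ (λ c → *-zeroʳ (m c))) (sum-replicate-zero n) ⟩
  0ℚ              ≤⟨ Φ-nonneg C m o ⟩
  Φ C m o         ≡⟨ sym (+-identityˡ (Φ C m o)) ⟩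
  0ℚ + Φ C m o    ∎
  where open ≤-Reasoning
amortized {n} {C} {m} d (r ∷ σ) (ys ∷ s) o = begin
  𝔼 m (λ c → expCost c C (r ∷ σ))
    ≡⟨ expCost-∷ σ ⟩
  cost + 𝔼 next (λ c → expCost c C′ σ)
    ≤⟨ +-monoʳ-≤ cost (amortized next-isDistOn σ s o′) ⟩
  cost + (κ * rest + Φ C′ next o′)
    ≡⟨ regroup cost (κ * rest) (Φ C′ next o′) ⟩
  (cost + Φ C′ next o′) + κ * rest
    ≤⟨ +-monoˡ-≤ (κ * rest) (amortized-step step o′) ⟩
  (κ * serve + Φ C m o′) + κ * rest
    ≤⟨ +-monoˡ-≤ (κ * rest) (+-monoʳ-≤ (κ * serve) (Φ-migrate C m o ys)) ⟩
  (κ * serve + (κ * migration + Φ C m o)) + κ * rest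
    ≡⟨ collect serve migration rest (Φ C m o) ⟩
  κ * (migration + serve + rest) + Φ C m o
    ≡⟨ cong (λ t → κ * t + Φ C m o) (sym (trans (fromℕℚ-+ (k ℕ.+ serveCost o′ r) (offCost o′ σ s))
                                               (cong (_+ rest) (fromℕℚ-+ k (serveCost o′ r))))) ⟩
  κ * fromℕℚ (offCost o (r ∷ σ) (ys ∷ s)) + Φ C m o ∎
  where
  step : Transition C m r
  step = transition d r
  open Transition step
  open ≤-Reasoning
  C′ : Subset n
  C′ = newCand C r
  o′ : Fin n
  o′ = proj₁ (migrateAll o ys)
  k : ℕ
  k = proj₂ (migrateAll o ys)
  migration serve rest : ℚ
  migration = fromℕℚ k
  serve     = fromℕℚ (serveCost o′ r)
  rest      = fromℕℚ (offCost o′ σ s)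
  regroup : ∀ c t p → c + (t + p) ≡ (c + p) + t
  regroup = solve-∀ ℚ-ring
  collect : ∀ s g t p → (κ * s + (κ * g + p)) + κ * t ≡ κ * (g + s + t) + p
  collect = solve-∀ ℚ-ring

theorem4 : (n : ℕ) (x₀ : Fin n) (σ : List (Request n)) (s : Schedule n σ) →
    E-ALG x₀ σ ≤ ℚ[ 11 / 9 ] * fromℕℚ (offCost x₀ σ s)
theorem4 n x₀ σ s = begin
  E-ALG x₀ σ
    ≡⟨ sym (𝔼-δ x₀ (λ c → expCost c ⁅ x₀ ⁆ σ)) ⟩
  𝔼 (δ x₀) (λ c → expCost c ⁅ x₀ ⁆ σ)
    ≤⟨ amortized (δ-isDistOn {C = ⁅ x₀ ⁆} x₀∈⁅x₀⁆) σ s x₀ ⟩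
  κ * fromℕℚ (offCost x₀ σ s) + Φ ⁅ x₀ ⁆ (δ x₀) x₀
    ≤⟨ +-monoʳ-≤ (κ * fromℕℚ (offCost x₀ σ s)) Φ-initial ⟩
  κ * fromℕℚ (offCost x₀ σ s) + 0ℚ
    ≡⟨ +-identityʳ _ ⟩
  κ * fromℕℚ (offCost x₀ σ s) ∎
  where
  open ≤-Reasoning
  x₀∈⁅x₀⁆ : lookup ⁅ x₀ ⁆ x₀ ≡ true
  x₀∈⁅x₀⁆ = trans (lookup-⁅⁆ x₀ x₀) (==-refl x₀)
  only-x₀ : ∀ c → lookup ⁅ x₀ ⁆ c ≡ true → c ≡ x₀
  only-x₀ c c∈ with x₀ ≟ c | trans (sym (lookup-⁅⁆ x₀ c)) c∈
  ... | yes x₀≡c | _ = sym x₀≡c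
  Φ-initial : Φ ⁅ x₀ ⁆ (δ x₀) x₀ ≤ 0ℚ
  Φ-initial = +-mono-≤ (G-point ⁅ x₀ ⁆ only-x₀) (≤-reflexive (ι-member ⁅ x₀ ⁆ x₀∈⁅x₀⁆))
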